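{- Let $n$ be a positive integer which is not a power of $2$, and let $k=\lfloor\log_2 n\rfloor$. The long hyperbinary expansions of $n$, together with the arcs of $A(n)$ connecting them, form a subgraph $L(n)$ of $A(n)$ isomorphic to $A(n-2^k)$.
   Context: A hyperbinary expansion of a positive integer $n$ is a word $x_1\cdots x_k$ over the alphabet $\{0,1,2\}$ with $x_1\neq 0$ and $n=\sum_{i=1}^k x_i2^{k-i}$; $\mathcal H(n)$ denotes the set of hyperbinary expansions of $n$. Every hyperbinary expansion of $n$ has length $\lfloor\log_2 n\rfloor$ (called short) or $\lfloor\log_2 n\rfloor+1$ (called long). Words are regarded up to leading zeros. Single-step reductions are: (I) $2\vec y \to 1\,0\,\vec y$; (II) $\vec x\,0\,2\,\vec y\to \vec x\,1\,0\,\vec y$; (III) $\vec x\,1\,2\,\vec y \twoheadrightarrow \vec x\,2\,0\,\vec y$, for words $\vec x,\vec y$ over $\{0,1,2\}$. If $\vec u$ is transformed into $\vec v$ by one single-step reduction, $\vec v$ is a child of $\vec u$. $A(n)$ is the directed graph with vertex set $\mathcal H(n)$ and an arc from $\vec u$ to $\vec v$ iff $\vec v$ is a child of $\vec u$; arcs from reductions of type I or II are coloured "$\to$", those of type III are coloured "$\twoheadrightarrow$". -}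

module Defs where

open import Data.Nat using (ℕ; zero; suc; _+_; _*_; _∸_; _^_; _≤_)
open import Data.Nat.Logarithm using (⌊log₂_⌋)
open import Data.List using (List; []; _∷_; _++_; length; foldl; replicate)
open import Data.Bool using (Bool; true; false; T)
open import Data.Product using (Σ; ∃; _×_; _,_; proj₁)
open import Relation.Binary.PropositionalEquality using (_≡_)

data Digit : Set where
  d0 d1 d2 : Digit

digitVal : Digit → ℕ
digitVal d0 = 0
digitVal d1 = 1
digitVal d2 = 2

value : List Digit → ℕ
value = foldl (λ acc d → 2 * acc + digitVal d) 0

leadingNonzero : List Digit → Bool
leadingNonzero []        = false
leadingNonzero (d0 ∷ _)  = false
leadingNonzero (d1 ∷ _)  = true
leadingNonzero (d2 ∷ _)  = true

IsHyper : ℕ → List Digit → Set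
IsHyper n w = T (leadingNonzero w) × value w ≡ n

H : ℕ → Set
H n = Σ (List Digit) (IsHyper n)

word : ∀ {n} → H n → List Digit
word = proj₁

LongH : ℕ → Set
LongH n = Σ (H n) (λ h → length (word h) ≡ suc ⌊log₂ n ⌋)

data Colour : Set where
  arrow     : Colour
  twohead   : Colour

data Reduce : Colour → List Digit → List Digit → Set where
  typeI   : ∀ y   → Reduce arrow   (d2 ∷ y) (d1 ∷ d0 ∷ y)
  typeII  : ∀ x y → Reduce arrow   (x ++ d0 ∷ d2 ∷ y) (x ++ d1 ∷ d0 ∷ y)
  typeIII : ∀ x y → Reduce twohead (x ++ d1 ∷ d2 ∷ y) (x ++ d2 ∷ d0 ∷ y)

-- words are regarded up to leading zeros: v is a child of u (via colour c)
-- if some zero-padded copy of u reduces in one step to some zero-padded copy of v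
Child : Colour → List Digit → List Digit → Set
Child c u v = ∃ λ i → ∃ λ j → Reduce c (replicate i d0 ++ u) (replicate j d0 ++ v)

ArcA : ∀ {n} → Colour → H n → H n → Set
ArcA c u v = Child c (word u) (word v)

ArcL : ∀ {n} → Colour → LongH n → LongH n → Set
ArcL c u v = ArcA c (proj₁ u) (proj₁ v)

-- A long expansion of n cannot begin with 2 (its value would be at least 2^(k+1) > n),
-- so it is 1 followed by a k-digit word of value m = n − 2^k; stripping the leading 1
-- and the leading zeros is a bijection onto 𝓗(m), whose inverse pads back to k digits.
-- Every reduction rewrites one digit pair 02 → 10 or 12 → 20 in place (type I is type II
-- on the word padded by one zero), so between words of equal length a reduction is
-- unaffected by a common prefix, and up to leading zeros it is unaffected by zero padding.
module Submission where

open import Defs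
open import Data.Nat using (ℕ; zero; suc; _+_; _*_; _∸_; _^_; _≤_; _<_; z≤n; s≤s; ⌊_/2⌋)
open import Data.Nat.Properties
open import Data.Nat.Logarithm using (⌊log₂_⌋; ⌊log₂⌋-mono-≤; ⌊log₂[2^n]⌋≡n; ⌊log₂⌊n/2⌋⌋≡⌊log₂n⌋∸1)
open import Data.Nat.Tactic.RingSolver using (solve-∀)
open import Data.List using (List; []; _∷_; _++_; length; foldl; replicate)
open import Data.List.Properties using (length-++; length-replicate; ++-assoc)
open import Data.Bool using (T)
open import Data.Bool.Properties using (T-irrelevant)
open import Data.Unit using (tt)
open import Data.Empty using (⊥-elim)
open import Data.Product using (Σ; ∃; _×_; _,_; proj₁)
open import Function.Definitions using (Bijective)
open import Function.Bundles using (_⇔_; mk⇔; Equivalence)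
open import Function.Consequences.Propositional
  using (inverseᵇ⇒bijective; strictlyInverseˡ⇒inverseˡ; strictlyInverseʳ⇒inverseʳ)
open import Function.Construct.Symmetry using (⇔-sym)
open import Function.Related.Propositional using (module EquationalReasoning)
open import Relation.Binary.PropositionalEquality
open import Relation.Nullary using (¬_)

2^⌊log₂⌋≤ : ∀ n → 1 ≤ n → 2 ^ ⌊log₂ n ⌋ ≤ n
2^⌊log₂⌋≤ n = go ⌊log₂ n ⌋ n refl
  where
  go : ∀ k n → ⌊log₂ n ⌋ ≡ k → 1 ≤ n → 2 ^ k ≤ n
  go zero    n       _ 1≤n = 1≤n
  go (suc k) n@(suc (suc _)) log≡ _ = begin
    2 * 2 ^ k       ≤⟨ *-monoʳ-≤ 2 (go k ⌊ n /2⌋ half-log≡ (s≤s z≤n)) ⟩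
    2 * ⌊ n /2⌋     ≡⟨ cong (⌊ n /2⌋ +_) (+-identityʳ _) ⟩
    ⌊ n /2⌋ + ⌊ n /2⌋ ≤⟨ +-monoʳ-≤ ⌊ n /2⌋ (⌊n/2⌋≤⌈n/2⌉ n) ⟩
    ⌊ n /2⌋ + _     ≡⟨ ⌊n/2⌋+⌈n/2⌉≡n n ⟩
    n               ∎
    where
    open ≤-Reasoning
    half-log≡ : ⌊log₂ ⌊ n /2⌋ ⌋ ≡ k
    half-log≡ = trans (⌊log₂⌊n/2⌋⌋≡⌊log₂n⌋∸1 n) (cong (_∸ 1) log≡)

<2^suc⌊log₂⌋ : ∀ n → n < 2 ^ suc ⌊log₂ n ⌋
<2^suc⌊log₂⌋ n = ≰⇒> λ 2^≤n →
  1+n≰n (subst (_≤ ⌊log₂ n ⌋) (⌊log₂[2^n]⌋≡n (suc ⌊log₂ n ⌋)) (⌊log₂⌋-mono-≤ 2^≤n))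

zeros : ℕ → List Digit
zeros i = replicate i d0

length-zeros-++ : ∀ i u → length (zeros i ++ u) ≡ i + length u
length-zeros-++ i u = trans (length-++ (zeros i)) (cong (_+ length u) (length-replicate i))

zeros-++-zeros : ∀ i j u → zeros i ++ (zeros j ++ u) ≡ zeros (i + j) ++ u
zeros-++-zeros zero    j u = refl
zeros-++-zeros (suc i) j u = cong (d0 ∷_) (zeros-++-zeros i j u)

pushDigit : ℕ → Digit → ℕ
pushDigit acc d = 2 * acc + digitVal d

foldl-pushDigit : ∀ acc t → foldl pushDigit acc t ≡ acc * 2 ^ length t + value t
foldl-pushDigit acc [] = sym (trans (+-identityʳ _) (*-identityʳ acc))
foldl-pushDigit acc (d ∷ t) = begin
  foldl pushDigit (pushDigit acc d) t                           ≡⟨ foldl-pushDigit (pushDigit acc d) t ⟩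
  (2 * acc + digitVal d) * 2 ^ length t + value t              ≡⟨ regroup acc (digitVal d) (2 ^ length t) (value t) ⟩
  acc * (2 * 2 ^ length t) + (digitVal d * 2 ^ length t + value t) ≡⟨ cong (acc * _ +_) (sym (foldl-pushDigit (digitVal d) t)) ⟩
  acc * 2 ^ length (d ∷ t) + foldl pushDigit (digitVal d) t    ∎
  where
  open ≡-Reasoning
  regroup : ∀ a b p v → (2 * a + b) * p + v ≡ a * (2 * p) + (b * p + v)
  regroup = solve-∀

value-∷ : ∀ d t → value (d ∷ t) ≡ digitVal d * 2 ^ length t + value t
value-∷ d t = foldl-pushDigit (digitVal d) t

value-zeros-++ : ∀ i w → value (zeros i ++ w) ≡ value w
value-zeros-++ zero    w = refl
value-zeros-++ (suc i) w = value-zeros-++ i w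

2^length≤value : ∀ d t → T (leadingNonzero (d ∷ t)) → 2 ^ length t ≤ value (d ∷ t)
2^length≤value d1 t _ = subst (2 ^ length t ≤_) (sym (value-∷ d1 t))
  (≤-trans (≤-reflexive (sym (*-identityˡ _))) (m≤m+n _ _))
2^length≤value d2 t _ = subst (2 ^ length t ≤_) (sym (value-∷ d2 t))
  (≤-trans (m≤m+n _ _) (m≤m+n _ _))

length≤ : ∀ j w → T (leadingNonzero w) → value w < 2 ^ j → length w ≤ j
length≤ j [] _ _ = z≤n
length≤ j (d ∷ t) lead value< = ≰⇒> λ j≤length →
  <⇒≱ value< (≤-trans (^-monoʳ-≤ 2 j≤length) (2^length≤value d t lead))

leadingZeros : List Digit → ℕ
leadingZeros (d0 ∷ w) = suc (leadingZeros w)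
leadingZeros _        = 0

dropZeros : List Digit → List Digit
dropZeros (d0 ∷ w) = dropZeros w
dropZeros w        = w

zeros-++-dropZeros : ∀ w → zeros (leadingZeros w) ++ dropZeros w ≡ w
zeros-++-dropZeros []       = refl
zeros-++-dropZeros (d0 ∷ w) = cong (d0 ∷_) (zeros-++-dropZeros w)
zeros-++-dropZeros (d1 ∷ w) = refl
zeros-++-dropZeros (d2 ∷ w) = refl

value-dropZeros : ∀ w → value (dropZeros w) ≡ value w
value-dropZeros w = trans (sym (value-zeros-++ (leadingZeros w) (dropZeros w)))
                          (cong value (zeros-++-dropZeros w))

leadingNonzero-dropZeros : ∀ w → value w ≢ 0 → T (leadingNonzero (dropZeros w))
leadingNonzero-dropZeros []       value≢0 = value≢0 refl
leadingNonzero-dropZeros (d0 ∷ w) value≢0 = leadingNonzero-dropZeros w value≢0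
leadingNonzero-dropZeros (d1 ∷ w) _       = tt
leadingNonzero-dropZeros (d2 ∷ w) _       = tt

dropZeros-zeros-++ : ∀ i w → T (leadingNonzero w) → dropZeros (zeros i ++ w) ≡ w
dropZeros-zeros-++ zero    (d1 ∷ w) _    = refl
dropZeros-zeros-++ zero    (d2 ∷ w) _    = refl
dropZeros-zeros-++ (suc i) w        lead = dropZeros-zeros-++ i w lead

padTo : ℕ → List Digit → List Digit
padTo k w = zeros (k ∸ length w) ++ w

length-padTo : ∀ {k} w → length w ≤ k → length (padTo k w) ≡ k
length-padTo {k} w length≤k = trans (length-zeros-++ (k ∸ length w) w) (m∸n+n≡m length≤k)

padTo-dropZeros : ∀ w → padTo (length w) (dropZeros w) ≡ w
padTo-dropZeros w = begin
  zeros (length w ∸ length s) ++ s                ≡⟨ cong (λ x → zeros (length x ∸ length s) ++ s) (sym (zeros-++-dropZeros w)) ⟩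
  zeros (length (zeros a ++ s) ∸ length s) ++ s   ≡⟨ cong (λ i → zeros (i ∸ length s) ++ s) (length-zeros-++ a s) ⟩
  zeros (a + length s ∸ length s) ++ s            ≡⟨ cong (λ i → zeros i ++ s) (m+n∸n≡m a (length s)) ⟩
  zeros a ++ s                                    ≡⟨ zeros-++-dropZeros w ⟩
  w                                               ∎
  where
  open ≡-Reasoning
  s = dropZeros w
  a = leadingZeros w

data Step : Colour → List Digit → List Digit → Set where
  here02 : ∀ y → Step arrow   (d0 ∷ d2 ∷ y) (d1 ∷ d0 ∷ y)
  here12 : ∀ y → Step twohead (d1 ∷ d2 ∷ y) (d2 ∷ d0 ∷ y)
  there  : ∀ {c u v} d → Step c u v → Step c (d ∷ u) (d ∷ v)

Step-++ : ∀ {c u v} x → Step c u v → Step c (x ++ u) (x ++ v)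
Step-++ []      s = s
Step-++ (d ∷ x) s = there d (Step-++ x s)

Step-∷⁻ : ∀ {c d u v} → Step c (d ∷ u) (d ∷ v) → Step c u v
Step-∷⁻ (there _ s) = s

Step-zeros-++⁻ : ∀ {c u v} i → Step c (zeros i ++ u) (zeros i ++ v) → Step c u v
Step-zeros-++⁻ zero    s = s
Step-zeros-++⁻ (suc i) s = Step-zeros-++⁻ i (Step-∷⁻ s)

Step-length : ∀ {c u v} → Step c u v → length u ≡ length v
Step-length (here02 y)  = refl
Step-length (here12 y)  = refl
Step-length (there d s) = cong suc (Step-length s)

Step⇒Reduce : ∀ {c u v} x → Step c u v → Reduce c (x ++ u) (x ++ v)
Step⇒Reduce x (here02 y) = typeII x y
Step⇒Reduce x (here12 y) = typeIII x y
Step⇒Reduce {c} x (there {u = u} {v} d s) =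
  subst₂ (Reduce c) (++-assoc x (d ∷ []) u) (++-assoc x (d ∷ []) v) (Step⇒Reduce (x ++ d ∷ []) s)

PaddedStep : Colour → List Digit → List Digit → Set
PaddedStep c u v = ∃ λ i → ∃ λ j → Step c (zeros i ++ u) (zeros j ++ v)

PaddedStep-zeros : ∀ {c u v} a b → PaddedStep c (zeros a ++ u) (zeros b ++ v) ⇔ PaddedStep c u v
PaddedStep-zeros {c} {u} {v} a b = mk⇔ to from
  where
  to : PaddedStep c (zeros a ++ u) (zeros b ++ v) → PaddedStep c u v
  to (i , j , s) = i + a , j + b , subst₂ (Step c) (zeros-++-zeros i a u) (zeros-++-zeros j b v) s
  from : PaddedStep c u v → PaddedStep c (zeros a ++ u) (zeros b ++ v)
  from (i , j , s) = b + i , a + j , subst₂ (Step c) left right (Step-++ (zeros (a + b)) s)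
    where
    left : zeros (a + b) ++ (zeros i ++ u) ≡ zeros (b + i) ++ (zeros a ++ u)
    left = trans (zeros-++-zeros (a + b) i u)
      (trans (cong (λ p → zeros p ++ u) (trans (+-assoc a b i) (+-comm a (b + i)))) (sym (zeros-++-zeros (b + i) a u)))
    right : zeros (a + b) ++ (zeros j ++ v) ≡ zeros (a + j) ++ (zeros b ++ v)
    right = trans (zeros-++-zeros (a + b) j v)
      (trans (cong (λ p → zeros p ++ v) (trans (+-assoc a b j) (trans (cong (a +_) (+-comm b j)) (sym (+-assoc a j b)))))
             (sym (zeros-++-zeros (a + j) b v)))

Reduce⇒PaddedStep : ∀ {c u v} → Reduce c u v → PaddedStep c u v
Reduce⇒PaddedStep (typeI y)     = 1 , 0 , here02 y
Reduce⇒PaddedStep (typeII x y)  = 0 , 0 , Step-++ x (here02 y)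
Reduce⇒PaddedStep (typeIII x y) = 0 , 0 , Step-++ x (here12 y)

Child⇔PaddedStep : ∀ {c u v} → Child c u v ⇔ PaddedStep c u v
Child⇔PaddedStep = mk⇔
  (λ (i , j , r) → Equivalence.to (PaddedStep-zeros i j) (Reduce⇒PaddedStep r))
  (λ (i , j , s) → i , j , Step⇒Reduce [] s)

PaddedStep⇔Step : ∀ {c u v} → length u ≡ length v → PaddedStep c u v ⇔ Step c u v
PaddedStep⇔Step {c} {u} {v} length≡ = mk⇔ to (λ s → 0 , 0 , s)
  where
  to : PaddedStep c u v → Step c u v
  to (i , j , s) with +-cancelʳ-≡ (length u) i j
    (trans (sym (length-zeros-++ i u))
      (trans (Step-length s) (trans (length-zeros-++ j v) (cong (j +_) (sym length≡)))))
  ... | refl = Step-zeros-++⁻ i s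

Step-∷⇔ : ∀ {c u v} d → Step c (d ∷ u) (d ∷ v) ⇔ Step c u v
Step-∷⇔ d = mk⇔ Step-∷⁻ (there d)

H-≡ : ∀ {n} {u v : H n} → word u ≡ word v → u ≡ v
H-≡ {u = w , lead , value≡} {v = .w , lead′ , value≡′} refl
  rewrite T-irrelevant lead lead′ | ≡-irrelevant value≡ value≡′ = refl

LongH-≡ : ∀ {n} {u v : LongH n} → word (proj₁ u) ≡ word (proj₁ v) → u ≡ v
LongH-≡ {u = u , length≡} {v = v , length≡′} word≡ with H-≡ {u = u} {v} word≡
... | refl rewrite ≡-irrelevant length≡ length≡′ = refl

module LongExpansions (n : ℕ) (1≤n : 1 ≤ n) (n≢2^ : ∀ j → ¬ (n ≡ 2 ^ j)) where

  k : ℕ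
  k = ⌊log₂ n ⌋

  m : ℕ
  m = n ∸ 2 ^ k

  2^k+m≡n : 2 ^ k + m ≡ n
  2^k+m≡n = m+[n∸m]≡n (2^⌊log₂⌋≤ n 1≤n)

  m<2^k : m < 2 ^ k
  m<2^k = +-cancelˡ-< (2 ^ k) m (2 ^ k)
    (subst₂ _<_ (sym 2^k+m≡n) (cong (2 ^ k +_) (+-identityʳ _)) (<2^suc⌊log₂⌋ n))

  m≢0 : m ≢ 0
  m≢0 m≡0 = n≢2^ k (trans (sym 2^k+m≡n) (trans (cong (2 ^ k +_) m≡0) (+-identityʳ _)))

  record Shape (u : LongH n) : Set where
    field
      tail        : List Digit
      word≡       : word (proj₁ u) ≡ d1 ∷ tail
      length-tail : length tail ≡ k
      value-tail  : value tail ≡ m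

  shape : (u : LongH n) → Shape u
  shape ((d1 ∷ t , _ , value≡) , length≡) = record
    { tail = t ; word≡ = refl ; length-tail = length-t ; value-tail = value-t }
    where
    length-t : length t ≡ k
    length-t = suc-injective length≡
    2^k+value-t : 2 ^ k + value t ≡ n
    2^k+value-t = begin
      2 ^ k + value t                  ≡⟨ cong (λ j → 2 ^ j + value t) (sym length-t) ⟩
      2 ^ length t + value t           ≡⟨ cong (_+ value t) (sym (*-identityˡ _)) ⟩
      1 * 2 ^ length t + value t       ≡⟨ sym (value-∷ d1 t) ⟩
      value (d1 ∷ t)                   ≡⟨ value≡ ⟩
      n                                ∎
      where open ≡-Reasoning
    value-t : value t ≡ m
    value-t = trans (sym (m+n∸m≡n (2 ^ k) (value t))) (cong (_∸ 2 ^ k) 2^k+value-t)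
  shape ((d2 ∷ t , _ , value≡) , length≡) = ⊥-elim (<⇒≱ (<2^suc⌊log₂⌋ n) 2^suc-k≤n)
    where
    2^suc-k≤n : 2 ^ suc k ≤ n
    2^suc-k≤n = subst₂ (λ j x → 2 * 2 ^ j ≤ x) (suc-injective length≡)
      (trans (sym (value-∷ d2 t)) value≡) (m≤m+n _ _)

  tailExpansion : LongH n → H m
  tailExpansion u = dropZeros tail , leadingNonzero-dropZeros tail (λ value≡0 → m≢0 (trans (sym value-tail) value≡0))
                             , trans (value-dropZeros tail) value-tail
    where open Shape (shape u)

  longExpansion : H m → LongH n
  longExpansion (w , lead , value≡) = (d1 ∷ padTo k w , tt , value-padded) , cong suc length-padded
    where
    length-padded : length (padTo k w) ≡ k
    length-padded = length-padTo w (length≤ k w lead (subst (_< 2 ^ k) (sym value≡) m<2^k))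
    value-padded : value (d1 ∷ padTo k w) ≡ n
    value-padded = begin
      value (d1 ∷ padTo k w)                         ≡⟨ value-∷ d1 (padTo k w) ⟩
      1 * 2 ^ length (padTo k w) + value (padTo k w) ≡⟨ cong₂ _+_ (trans (*-identityˡ _) (cong (2 ^_) length-padded))
                                                                  (value-zeros-++ (k ∸ length w) w) ⟩
      2 ^ k + value w                                ≡⟨ cong (2 ^ k +_) value≡ ⟩
      2 ^ k + m                                      ≡⟨ 2^k+m≡n ⟩
      n                                              ∎
      where open ≡-Reasoning

  tailExpansion-longExpansion : ∀ w → tailExpansion (longExpansion w) ≡ w
  tailExpansion-longExpansion (w , lead , _) = H-≡ (dropZeros-zeros-++ (k ∸ length w) w lead)

  longExpansion-tailExpansion : ∀ u → longExpansion (tailExpansion u) ≡ u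
  longExpansion-tailExpansion u = LongH-≡ (begin
    d1 ∷ padTo k (dropZeros tail)             ≡⟨ cong (λ j → d1 ∷ padTo j (dropZeros tail)) (sym length-tail) ⟩
    d1 ∷ padTo (length tail) (dropZeros tail) ≡⟨ cong (d1 ∷_) (padTo-dropZeros tail) ⟩
    d1 ∷ tail                                 ≡⟨ sym word≡ ⟩
    word (proj₁ u)                            ∎)
    where
    open ≡-Reasoning
    open Shape (shape u)

  tailExpansion-bijective : Bijective _≡_ _≡_ tailExpansion
  tailExpansion-bijective = inverseᵇ⇒bijective
    ( strictlyInverseˡ⇒inverseˡ {f⁻¹ = longExpansion} tailExpansion tailExpansion-longExpansion
    , strictlyInverseʳ⇒inverseʳ {f⁻¹ = longExpansion} tailExpansion longExpansion-tailExpansion )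

  tailExpansion-arcs : ∀ c u v → ArcL c u v ⇔ ArcA c (tailExpansion u) (tailExpansion v)
  tailExpansion-arcs c u v = begin
    Child c (word (proj₁ u)) (word (proj₁ v))   ≡⟨ cong₂ (Child c) U.word≡ V.word≡ ⟩
    Child c (d1 ∷ t) (d1 ∷ t′)                  ∼⟨ Child⇔PaddedStep ⟩
    PaddedStep c (d1 ∷ t) (d1 ∷ t′)             ∼⟨ PaddedStep⇔Step (cong suc length≡) ⟩
    Step c (d1 ∷ t) (d1 ∷ t′)                   ∼⟨ Step-∷⇔ d1 ⟩
    Step c t t′                                 ∼⟨ ⇔-sym (PaddedStep⇔Step length≡) ⟩
    PaddedStep c t t′                           ≡⟨ cong₂ (PaddedStep c) (sym (zeros-++-dropZeros t))
                                                                         (sym (zeros-++-dropZeros t′)) ⟩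
    PaddedStep c (zeros (leadingZeros t) ++ dropZeros t) (zeros (leadingZeros t′) ++ dropZeros t′)
                                                ∼⟨ PaddedStep-zeros (leadingZeros t) (leadingZeros t′) ⟩
    PaddedStep c (dropZeros t) (dropZeros t′)   ∼⟨ ⇔-sym Child⇔PaddedStep ⟩
    Child c (dropZeros t) (dropZeros t′)        ∎
    where
    open EquationalReasoning
    module U = Shape (shape u)
    module V = Shape (shape v)
    t = U.tail
    t′ = V.tail
    length≡ : length t ≡ length t′
    length≡ = trans U.length-tail (sym V.length-tail)

proposition4p2 : (n : ℕ) → 1 ≤ n → (∀ j → ¬ (n ≡ 2 ^ j)) →
    Σ (LongH n → H (n ∸ 2 ^ ⌊log₂ n ⌋)) (λ f →
    Bijective _≡_ _≡_ f ×
    (∀ c u v → ArcL c u v ⇔ ArcA c (f u) (f v)))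
proposition4p2 n 1≤n n≢2^ = tailExpansion , tailExpansion-bijective , tailExpansion-arcs
  where open LongExpansions n 1≤n n≢2^
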